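{- Let $P$ be a PLSC of order $n$ in which automatic elimination has been performed, and consider any run of the primary extension procedure on $P$, with $D_1,D_2,\ldots,D_k$ the sequence of cells treated (in which dots were replaced by rooks). Then any two distinct cells of this sequence have Hamming distance at least $2$, i.e. no two of them lie on a common line.
   Context: A PLSC (partial Latin super cube) of order $n$ is an assignment to each cell of $\{1,\ldots,n\}^3$ of one of three states: rook, dot, or empty, such that no two rooks lie on a common line (a line, or file, is a set of $n$ cells obtained by fixing two coordinates). Automatic elimination means making empty every dot that lies on a line containing a rook. An eliminated file is a line containing neither a rook nor a dot. A dot is desolate if some line contains it as its only dot (and no rook). The primary extension procedure: start with $P_0=P$; repeatedly: if every line contains a rook, stop; if there is an eliminated file, stop; if there is no desolate dot, stop; otherwise select an arbitrary desolate dot, replace it by a rook, perform automatic elimination, and repeat. -}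

module Defs where

open import Data.Nat using (ℕ; _+_; _≤_)
open import Data.Fin using (Fin)
import Data.Fin as Fin
open import Data.Product using (Σ; _×_; _,_; Σ-syntax)
open import Data.Product.Properties using (≡-dec)
open import Data.Sum using (_⊎_)
open import Data.List using (List; []; _∷_)
open import Relation.Binary.PropositionalEquality using (_≡_; _≢_)
open import Relation.Nullary using (¬_; yes; no)

data St : Set where
  rook dot empty : St

-- Cells of {1..n}^3 (indexed by Fin n)
Cell : ℕ → Set
Cell n = Fin n × Fin n × Fin n

Config : ℕ → Set
Config n = Cell n → St

-- Lines (files): fix two coordinates, the free one is named by the constructor
data Line (n : ℕ) : Set where
  line₁ : Fin n → Fin n → Line n
  line₂ : Fin n → Fin n → Line n
  line₃ : Fin n → Fin n → Line n

InLine : ∀ {n} → Cell n → Line n → Set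
InLine (x , y , z) (line₁ b c) = (y ≡ b) × (z ≡ c)
InLine (x , y , z) (line₂ a c) = (x ≡ a) × (z ≡ c)
InLine (x , y , z) (line₃ a b) = (x ≡ a) × (y ≡ b)

IsPLSC : ∀ {n} → Config n → Set
IsPLSC {n} P = (L : Line n) (c d : Cell n) → InLine c L → InLine d L →
  P c ≡ rook → P d ≡ rook → c ≡ d

LineHasRook : ∀ {n} → Config n → Line n → Set
LineHasRook {n} P L = Σ[ d ∈ Cell n ] (InLine d L × P d ≡ rook)

OnRookLine : ∀ {n} → Config n → Cell n → Set
OnRookLine {n} P c = Σ[ L ∈ Line n ] (InLine c L × LineHasRook P L)

AutoElim : ∀ {n} → Config n → Config n → Set
AutoElim {n} P Q = (c : Cell n) →
  ((P c ≡ dot × OnRookLine P c) → Q c ≡ empty) ×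
  (¬ (P c ≡ dot × OnRookLine P c) → Q c ≡ P c)

EliminatedFile : ∀ {n} → Config n → Line n → Set
EliminatedFile {n} P L = (c : Cell n) → InLine c L → P c ≡ empty

Desolate : ∀ {n} → Config n → Cell n → Set
Desolate {n} P D = (P D ≡ dot) × (Σ[ L ∈ Line n ]
  (InLine D L × ((c : Cell n) → InLine c L → P c ≢ rook)
              × ((c : Cell n) → InLine c L → P c ≡ dot → c ≡ D)))

_≟c_ : ∀ {n} (c d : Cell n) → Relation.Nullary.Dec (c ≡ d)
_≟c_ = ≡-dec Fin._≟_ (≡-dec Fin._≟_ Fin._≟_)

placeRook : ∀ {n} → Config n → Cell n → Config n
placeRook P D c with D ≟c c
... | yes _ = rook
... | no _ = P c

Step : ∀ {n} → Config n → Cell n → Config n → Set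
Step {n} P D Q =
  ¬ ((L : Line n) → LineHasRook P L) ×
  ¬ (Σ[ L ∈ Line n ] EliminatedFile P L) ×
  Desolate P D ×
  AutoElim (placeRook P D) Q

Stopped : ∀ {n} → Config n → Set
Stopped {n} P = ((L : Line n) → LineHasRook P L)
  ⊎ (Σ[ L ∈ Line n ] EliminatedFile P L)
  ⊎ ((D : Cell n) → ¬ Desolate P D)

-- Run P Ds R : the procedure started at P treats the cells Ds (in order) reaching R
data Run {n : ℕ} : Config n → List (Cell n) → Config n → Set where
  done : ∀ {P} → Run P [] P
  step : ∀ {P D Q Ds R} → Step P D Q → Run Q Ds R → Run P (D ∷ Ds) R

diff : ∀ {n} → Fin n → Fin n → ℕ
diff a b with a Fin.≟ b
... | yes _ = 0
... | no _ = 1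

hamming : ∀ {n} → Cell n → Cell n → ℕ
hamming (x , y , z) (x' , y' , z') = diff x x' + diff y y' + diff z z'

{-# OPTIONS --safe #-}
-- Proof idea: a treated cell D is a dot when it is treated and a rook right
-- after, so automatic elimination empties every dot collinear with D, and a
-- cell that is not a dot never becomes one again.  Hence no cell collinear with
-- D is treated later.  Distinct cells that are not collinear differ in at least
-- two coordinates.
module Submission where

open import Defs
open import Data.Nat using (ℕ; _≤_; s≤s; z≤n)
open import Data.List using (List)
open import Data.List.Membership.Propositional using (_∈_; _∉_)
open import Data.List.Relation.Unary.Any using (here; there)
open import Data.Product using (_×_; _,_; Σ-syntax; proj₁; proj₂)
open import Data.Empty using (⊥-elim)
open import Relation.Binary.PropositionalEquality using (_≡_; _≢_; refl; sym; trans)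
open import Relation.Nullary using (¬_; Dec; yes; no)
import Data.Fin as Fin

Collinear : ∀ {n} → Cell n → Cell n → Set
Collinear {n} c d = Σ[ L ∈ Line n ] (InLine c L × InLine d L)

collinear-sym : ∀ {n} {c d : Cell n} → Collinear c d → Collinear d c
collinear-sym (L , c∈L , d∈L) = L , d∈L , c∈L

distinct-non-collinear⇒2≤hamming : ∀ {n} (c d : Cell n) → c ≢ d → ¬ Collinear c d → 2 ≤ hamming c d
distinct-non-collinear⇒2≤hamming (x , y , z) (x' , y' , z') c≢d ¬col
  with x Fin.≟ x' | y Fin.≟ y' | z Fin.≟ z'
... | yes refl | yes refl | yes refl = ⊥-elim (c≢d refl)
... | yes refl | yes refl | no _ = ⊥-elim (¬col (line₃ x y , (refl , refl) , (refl , refl)))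
... | yes refl | no _ | yes refl = ⊥-elim (¬col (line₂ x z , (refl , refl) , (refl , refl)))
... | no _ | yes refl | yes refl = ⊥-elim (¬col (line₁ y z , (refl , refl) , (refl , refl)))
... | no _ | no _ | _ = s≤s (s≤s z≤n)
... | no _ | yes _ | no _ = s≤s (s≤s z≤n)
... | yes _ | no _ | no _ = s≤s (s≤s z≤n)

placeRook-self : ∀ {n} (P : Config n) D → placeRook P D D ≡ rook
placeRook-self P D with D ≟c D
... | yes _ = refl
... | no D≢D = ⊥-elim (D≢D refl)

dot? : (s : St) → Dec (s ≡ dot)
dot? rook = no λ ()
dot? dot = yes refl
dot? empty = no λ ()

autoElim-non-dot : ∀ {n} {S Q : Config n} c → AutoElim S Q → S c ≢ dot → Q c ≡ S c
autoElim-non-dot c elim Sc≢dot = proj₂ (elim c) (λ (Sc≡dot , _) → Sc≢dot Sc≡dot)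

autoElim-clears-rook-line : ∀ {n} {S Q : Config n} {L c} →
  AutoElim S Q → InLine c L → LineHasRook S L → Q c ≢ dot
autoElim-clears-rook-line {S = S} {Q} {L} {c} elim c∈L rook∈L with dot? (S c)
... | yes Sc≡dot = λ Qc≡dot → empty≢dot (trans (sym Qc≡empty) Qc≡dot)
  where
  Qc≡empty : Q c ≡ empty
  Qc≡empty = proj₁ (elim c) (Sc≡dot , L , c∈L , rook∈L)
  empty≢dot : empty ≢ dot
  empty≢dot ()
... | no Sc≢dot = λ Qc≡dot → Sc≢dot (trans (sym (autoElim-non-dot c elim Sc≢dot)) Qc≡dot)

placeRook-non-dot : ∀ {n} (P : Config n) D c → P c ≢ dot → placeRook P D c ≢ dot
placeRook-non-dot P D c Pc≢dot with D ≟c c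
... | yes _ = λ ()
... | no _ = Pc≢dot

step-non-dot : ∀ {n} {P Q : Config n} {D c} → Step P D Q → P c ≢ dot → Q c ≢ dot
step-non-dot {P = P} {D = D} {c} (_ , _ , _ , elim) Pc≢dot Qc≡dot =
  Sc≢dot (trans (sym (autoElim-non-dot c elim Sc≢dot)) Qc≡dot)
  where
  Sc≢dot : placeRook P D c ≢ dot
  Sc≢dot = placeRook-non-dot P D c Pc≢dot

step-clears-lines : ∀ {n} {P Q : Config n} {D c} → Step P D Q → Collinear D c → Q c ≢ dot
step-clears-lines {P = P} {D = D} (_ , _ , _ , elim) (L , D∈L , c∈L) =
  autoElim-clears-rook-line elim c∈L (D , D∈L , placeRook-self P D)

run-treats-only-dots : ∀ {n} {P R : Config n} {Ds c} → Run P Ds R → P c ≢ dot → c ∉ Ds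
run-treats-only-dots (step (_ , _ , (Pc≡dot , _) , _) _) Pc≢dot (here refl) = Pc≢dot Pc≡dot
run-treats-only-dots (step st run) Pc≢dot (there c∈Ds) =
  run-treats-only-dots run (step-non-dot st Pc≢dot) c∈Ds

run-treated-not-collinear : ∀ {n} {P R : Config n} {Ds c d} →
  Run P Ds R → c ∈ Ds → d ∈ Ds → c ≢ d → ¬ Collinear c d
run-treated-not-collinear (step _ _) (here refl) (here refl) c≢d _ = c≢d refl
run-treated-not-collinear (step st run) (here refl) (there d∈Ds) _ col =
  run-treats-only-dots run (step-clears-lines st col) d∈Ds
run-treated-not-collinear (step st run) (there c∈Ds) (here refl) _ col =
  run-treats-only-dots run (step-clears-lines st (collinear-sym col)) c∈Ds
run-treated-not-collinear (step _ run) (there c∈Ds) (there d∈Ds) c≢d col =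
  run-treated-not-collinear run c∈Ds d∈Ds c≢d col

corollary3p3 : (n : ℕ) (P : Config n) → IsPLSC P → AutoElim P P →
    (Ds : List (Cell n)) (R : Config n) → Run P Ds R → Stopped R →
    (c d : Cell n) → c ∈ Ds → d ∈ Ds → c ≢ d → 2 ≤ hamming c d
corollary3p3 n P _ _ Ds R run _ c d c∈Ds d∈Ds c≢d =
  distinct-non-collinear⇒2≤hamming c d c≢d (run-treated-not-collinear run c∈Ds d∈Ds c≢d)
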